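{- Let $n\ge 11$ and $T_{n,n-1}=\frac{n(n+1)}{2}-(n-1)$. Then $\#\mathbb U^*_{T_{n,n-1}}=1$.
   Context: A partition of $N$ into distinct parts is a sequence of positive integers $\lambda_1<\dots<\lambda_t$ summing to $N$ with $t\ge 2$. Its missing parts are the elements of $\{1,\dots,\lambda_t\}\setminus\{\lambda_1,\dots,\lambda_t\}$. $\lambda$ is refinable if two distinct missing parts sum to a part of $\lambda$, unrefinable otherwise; $\mathbb U_N$ is the set of unrefinable partitions of $N$. $\mathbb U^*_N$ is the set of $\lambda\in\mathbb U_N$ whose largest part is the maximum of the largest parts over all of $\mathbb U_N$. Standing assumption: $n\ge 11$. -}

module Defs where

open import Data.Nat using (ℕ; _+_; _*_; _∸_; _<_; _≤_; _⊔_; _/_)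
open import Data.List using (List; length; foldr)
open import Data.Nat.ListAction using (sum)
open import Data.List.Membership.Propositional using (_∈_; _∉_)
open import Data.List.Relation.Unary.All using (All)
open import Data.List.Relation.Unary.Linked using (Linked)
open import Data.Product using (_×_; ∃-syntax; Σ-syntax)
open import Relation.Binary.PropositionalEquality using (_≡_; _≢_)
open import Relation.Nullary using (¬_)

record IsDistinctPartition (N : ℕ) (λs : List ℕ) : Set where
  field
    increasing : Linked _<_ λs
    positive   : All (0 <_) λs
    atLeastTwo : 2 ≤ length λs
    sums       : sum λs ≡ N

largest : List ℕ → ℕ
largest = foldr _⊔_ 0

Missing : List ℕ → ℕ → Set
Missing λs m = (1 ≤ m) × (m ≤ largest λs) × (m ∉ λs)

Refinable : List ℕ → Set
Refinable λs = ∃[ a ] ∃[ b ] (a ≢ b × Missing λs a × Missing λs b × (a + b) ∈ λs)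

Unrefinable : ℕ → List ℕ → Set
Unrefinable N λs = IsDistinctPartition N λs × ¬ Refinable λs

MaxUnrefinable : ℕ → List ℕ → Set
MaxUnrefinable N λs =
  Unrefinable N λs × (∀ μs → Unrefinable N μs → largest μs ≤ largest λs)

ExactlyOneMax : ℕ → Set
ExactlyOneMax N = Σ[ λs ∈ List ℕ ] (MaxUnrefinable N λs × (∀ μs → MaxUnrefinable N μs → μs ≡ λs))

T : ℕ → ℕ
T n = (n * (n + 1)) / 2 ∸ (n ∸ 1)

-- Write n = m + 4, so that T_{n,n-1} = m(m+1)/2 + (m + 3) + (2m + 4). Let μ be an unrefinable
-- partition of it with largest part L. For 1 ≤ a < L/2 the numbers a and L - a are distinct and sum
-- to the part L, so at least one of them is a part; grouping the parts of μ into such pairs gives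
-- sum μ ≥ (1 + ⋯ + r) + L whenever 2r < L. Taking r = m + 2 shows L ≤ 2m + 4, a bound attained by
-- the unrefinable partition λ = {1, …, m, m + 3, 2m + 4}. When L = 2m + 4 the estimate with r = m + 1
-- is tight up to 2, which forces a ∈ μ and L - a ∉ μ for every a ≤ m; the remaining weight m + 3 must
-- then be carried by m + 1, m + 2 and m + 3, and only the part m + 3 itself fits. Hence μ = λ.

module Submission where

open import Data.Empty using (⊥; ⊥-elim)
open import Data.List using (List; []; _∷_; length)
open import Data.List.Membership.Propositional using (_∈_; _∉_)
open import Data.List.Relation.Unary.All as All using (All; []; _∷_)
open import Data.List.Relation.Unary.Any using (here; there)
open import Data.List.Relation.Unary.Linked as Linked using (Linked; []; [-]; _∷_)
open import Data.List.Relation.Unary.Linked.Properties using (Linked⇒All)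
open import Data.Nat
open import Data.Nat.DivMod using (m*n/n≡m)
open import Data.Nat.ListAction using (sum)
open import Data.Nat.Properties
open import Data.Nat.Tactic.RingSolver using (solve-∀)
open import Algebra.Properties.CommutativeSemigroup +-commutativeSemigroup
  using (interchange; x∙yz≈y∙xz; x∙yz≈xz∙y; xy∙z≈xz∙y)
open import Data.List.Membership.DecPropositional _≟_ using (_∈?_)
open import Data.Product using (_×_; _,_; proj₁; proj₂)
open import Data.Sum using (_⊎_; inj₁; inj₂; [_,_]′)
open import Function using (id; _∘_)
open import Relation.Binary.Definitions using (tri<; tri≈; tri>)
open import Relation.Binary.PropositionalEquality
open import Relation.Nullary using (¬_; yes; no)

open import Defs

sumFrom : (ℕ → ℕ) → ℕ → ℕ → ℕ
sumFrom f lo zero    = 0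
sumFrom f lo (suc k) = f lo + sumFrom f (suc lo) k

triangle : ℕ → ℕ
triangle = sumFrom id 1

Within : ℕ → ℕ → (ℕ → Set) → Set
Within lo k P = ∀ {y} → lo ≤ y → y < lo + k → P y

within-empty : ∀ {lo y} → lo ≤ y → y < lo + 0 → ⊥
within-empty {lo} {y} lo≤y y<lo+0 = n≮n y (<-≤-trans (subst (y <_) (+-identityʳ lo) y<lo+0) lo≤y)

within-cases : ∀ {lo k y} → lo ≤ y → y < lo + suc k → y ≡ lo ⊎ (suc lo ≤ y × y < suc lo + k)
within-cases {lo} {k} {y} lo≤y y<hi with m≤n⇒m<n∨m≡n lo≤y
... | inj₁ lo<y = inj₂ (lo<y , subst (y <_) (+-suc lo k) y<hi)
... | inj₂ lo≡y = inj₁ (sym lo≡y)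

within-head : ∀ {lo k P} → Within lo (suc k) P → P lo
within-head {lo} p = p ≤-refl (m<m+n lo z<s)

within-tail : ∀ {lo k P} → Within lo (suc k) P → Within (suc lo) k P
within-tail {lo} {k} p {y} lo<y y<hi = p (<⇒≤ lo<y) (subst (y <_) (sym (+-suc lo k)) y<hi)

sumFrom-zero : ∀ lo k → sumFrom (λ _ → 0) lo k ≡ 0
sumFrom-zero lo zero    = refl
sumFrom-zero lo (suc k) = sumFrom-zero (suc lo) k

sumFrom-snoc : ∀ f lo k → sumFrom f lo (suc k) ≡ sumFrom f lo k + f (lo + k)
sumFrom-snoc f lo zero    = trans (+-identityʳ (f lo)) (cong f (sym (+-identityʳ lo)))
sumFrom-snoc f lo (suc k) = begin
  f lo + sumFrom f (suc lo) (suc k)              ≡⟨ cong (f lo +_) (sumFrom-snoc f (suc lo) k) ⟩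
  f lo + (sumFrom f (suc lo) k + f (suc lo + k)) ≡⟨ sym (+-assoc (f lo) _ _) ⟩
  Σ + f (suc lo + k)                             ≡⟨ cong (λ z → Σ + f z) (sym (+-suc lo k)) ⟩
  Σ + f (lo + suc k)                             ∎
  where
    open ≡-Reasoning
    Σ = f lo + sumFrom f (suc lo) k

sumFrom-+ : ∀ f g lo k → sumFrom (λ y → f y + g y) lo k ≡ sumFrom f lo k + sumFrom g lo k
sumFrom-+ f g lo zero    = refl
sumFrom-+ f g lo (suc k) =
  trans (cong (f lo + g lo +_) (sumFrom-+ f g (suc lo) k)) (interchange (f lo) (g lo) _ _)

sumFrom-mono : ∀ f g lo k → Within lo k (λ y → g y ≤ f y) → sumFrom g lo k ≤ sumFrom f lo k
sumFrom-mono f g lo zero    g≤f = z≤n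
sumFrom-mono f g lo (suc k) g≤f =
  +-mono-≤ (within-head g≤f) (sumFrom-mono f g (suc lo) k (within-tail g≤f))

sumFrom-cong : ∀ f g lo k → Within lo k (λ y → g y ≡ f y) → sumFrom g lo k ≡ sumFrom f lo k
sumFrom-cong f g lo zero    g≡f = refl
sumFrom-cong f g lo (suc k) g≡f =
  cong₂ _+_ (within-head g≡f) (sumFrom-cong f g (suc lo) k (within-tail g≡f))

sumFrom-excess : ∀ f g lo k → Within lo k (λ y → g y ≤ f y) →
                 Within lo k (λ y → f y + sumFrom g lo k ≤ g y + sumFrom f lo k)
sumFrom-excess f g lo zero    g≤f lo≤y y<hi = ⊥-elim (within-empty lo≤y y<hi)
sumFrom-excess f g lo (suc k) g≤f {y} lo≤y y<hi with within-cases lo≤y y<hi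
... | inj₁ refl = begin
  f lo + (g lo + G) ≡⟨ x∙yz≈y∙xz (f lo) (g lo) G ⟩
  g lo + (f lo + G) ≤⟨ +-monoʳ-≤ (g lo) (+-monoʳ-≤ (f lo) G≤F) ⟩
  g lo + (f lo + F) ∎
  where
    open ≤-Reasoning
    F = sumFrom f (suc lo) k
    G = sumFrom g (suc lo) k
    G≤F : G ≤ F
    G≤F = sumFrom-mono f g (suc lo) k (within-tail g≤f)
... | inj₂ (lo<y , y<hi′) = begin
  f y + (g lo + G)  ≡⟨ x∙yz≈y∙xz (f y) (g lo) G ⟩
  g lo + (f y + G)  ≤⟨ +-monoʳ-≤ (g lo) (sumFrom-excess f g (suc lo) k (within-tail g≤f) lo<y y<hi′) ⟩
  g lo + (g y + F)  ≡⟨ x∙yz≈y∙xz (g lo) (g y) F ⟩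
  g y + (g lo + F)  ≤⟨ +-monoʳ-≤ (g y) (+-monoˡ-≤ F (within-head g≤f)) ⟩
  g y + (f lo + F)  ∎
  where
    open ≤-Reasoning
    F = sumFrom f (suc lo) k
    G = sumFrom g (suc lo) k

sumFrom-slack : ∀ f g lo k c → Within lo k (λ y → g y ≤ f y) →
                sumFrom f lo k ≤ sumFrom g lo k + c → Within lo k (λ y → f y ≤ g y + c)
sumFrom-slack f g lo k c g≤f Σf≤Σg+c {y} lo≤y y<hi = +-cancelʳ-≤ G (f y) (g y + c) (begin
  f y + G       ≤⟨ sumFrom-excess f g lo k g≤f lo≤y y<hi ⟩
  g y + F       ≤⟨ +-monoʳ-≤ (g y) Σf≤Σg+c ⟩
  g y + (G + c) ≡⟨ x∙yz≈xz∙y (g y) G c ⟩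
  g y + c + G   ∎)
  where
    open ≤-Reasoning
    F = sumFrom f lo k
    G = sumFrom g lo k

-- The hypothesis says that a ↦ S ∸ a reverses the range, so its first r terms pair off with its last r.
sumFrom-pairs : ∀ f lo r c S → lo + (lo + (r + c + r)) ≡ suc S →
  sumFrom f lo (r + c + r) ≡ sumFrom (λ a → f a + f (S ∸ a)) lo r + sumFrom f (lo + r) c
sumFrom-pairs f lo zero    c S _ = cong₂ (sumFrom f) (sym (+-identityʳ lo)) (+-identityʳ c)
sumFrom-pairs f lo (suc r) c S symmetric = begin
  sumFrom f lo (suc r + c + suc r)
    ≡⟨ cong (λ k → f lo + sumFrom f (suc lo) k) (+-suc (r + c) r) ⟩
  f lo + sumFrom f (suc lo) (suc (r + c + r))
    ≡⟨ cong (f lo +_) (sumFrom-snoc f (suc lo) (r + c + r)) ⟩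
  f lo + (sumFrom f (suc lo) (r + c + r) + f (suc lo + (r + c + r)))
    ≡⟨ cong₂ (λ u v → f lo + (u + f v)) (sumFrom-pairs f (suc lo) r c S inner) outer ⟩
  f lo + (sumFrom P (suc lo) r + sumFrom f (suc lo + r) c + f (S ∸ lo))
    ≡⟨ regroup (f lo) _ _ (f (S ∸ lo)) ⟩
  f lo + f (S ∸ lo) + sumFrom P (suc lo) r + sumFrom f (suc lo + r) c
    ≡⟨ cong (λ z → sumFrom P lo (suc r) + sumFrom f z c) (sym (+-suc lo r)) ⟩
  sumFrom P lo (suc r) + sumFrom f (lo + suc r) c ∎
  where
    open ≡-Reasoning
    P = λ a → f a + f (S ∸ a)
    regroup : ∀ a b c d → a + (b + c + d) ≡ a + d + b + c
    regroup = solve-∀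
    shift : ∀ lo r c → lo + (lo + (suc r + c + suc r)) ≡ suc lo + (suc lo + (r + c + r))
    shift = solve-∀
    inner : suc lo + (suc lo + (r + c + r)) ≡ suc S
    inner = trans (sym (shift lo r c)) symmetric
    S≡ : S ≡ lo + (suc lo + (r + c + r))
    S≡ = suc-injective (trans (sym symmetric) (shift lo r c))
    outer : suc lo + (r + c + r) ≡ S ∸ lo
    outer = sym (trans (cong (_∸ lo) S≡) (m+n∸m≡n lo _))

triangle-*2 : ∀ m → triangle m * 2 ≡ m * suc m
triangle-*2 zero    = refl
triangle-*2 (suc m) = begin
  triangle (suc m) * 2          ≡⟨ cong (_* 2) (sumFrom-snoc id 1 m) ⟩
  (triangle m + suc m) * 2      ≡⟨ *-distribʳ-+ 2 (triangle m) (suc m) ⟩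
  triangle m * 2 + suc m * 2    ≡⟨ cong (_+ suc m * 2) (triangle-*2 m) ⟩
  m * suc m + suc m * 2         ≡⟨ step m ⟩
  suc m * suc (suc m)           ∎
  where
    open ≡-Reasoning
    step : ∀ m → m * suc m + suc m * 2 ≡ suc m * suc (suc m)
    step = solve-∀

head<tail : ∀ {x xs} → Linked _<_ (x ∷ xs) → All (x <_) xs
head<tail [-]            = []
head<tail (x<y ∷ y∷ys↗) = Linked⇒All <-trans x<y y∷ys↗

head∉tail : ∀ {x xs} → Linked _<_ (x ∷ xs) → x ∉ xs
head∉tail {x} x∷xs↗ x∈xs = n≮n x (All.lookup (head<tail x∷xs↗) x∈xs)

cons-increasing : ∀ {x xs} → All (x <_) xs → Linked _<_ xs → Linked _<_ (x ∷ xs)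
cons-increasing []        _   = [-]
cons-increasing (x<y ∷ _) xs↗ = x<y ∷ xs↗

increasing-ext : ∀ {xs ys} → Linked _<_ xs → Linked _<_ ys →
                 (∀ {z} → z ∈ xs → z ∈ ys) → (∀ {z} → z ∈ ys → z ∈ xs) → xs ≡ ys
increasing-ext {[]}     {[]}     _ _ _ _ = refl
increasing-ext {[]}     {y ∷ ys} _ _ _ ys⊆ with () ← ys⊆ (here refl)
increasing-ext {x ∷ xs} {[]}     _ _ xs⊆ _ with () ← xs⊆ (here refl)
increasing-ext {x ∷ xs} {y ∷ ys} xs↗ ys↗ xs⊆ ys⊆ =
  cong₂ _∷_ x≡y (increasing-ext (Linked.tail xs↗) (Linked.tail ys↗) tail⊆ tail⊇)
  where
    x≡y : x ≡ y
    x≡y with xs⊆ (here refl) | ys⊆ (here refl)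
    ... | here x≡y   | _          = x≡y
    ... | there _    | here y≡x   = sym y≡x
    ... | there x∈ys | there y∈xs =
      ⊥-elim (<-asym (All.lookup (head<tail xs↗) y∈xs) (All.lookup (head<tail ys↗) x∈ys))
    tail⊆ : ∀ {z} → z ∈ xs → z ∈ ys
    tail⊆ z∈xs with xs⊆ (there z∈xs)
    ... | here z≡y   = ⊥-elim (head∉tail xs↗ (subst (_∈ xs) (trans z≡y (sym x≡y)) z∈xs))
    ... | there z∈ys = z∈ys
    tail⊇ : ∀ {z} → z ∈ ys → z ∈ xs
    tail⊇ z∈ys with ys⊆ (there z∈ys)
    ... | here z≡x   = ⊥-elim (head∉tail ys↗ (subst (_∈ ys) (trans z≡x x≡y) z∈ys))
    ... | there z∈xs = z∈xs

∈⇒≤largest : ∀ {x xs} → x ∈ xs → x ≤ largest xs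
∈⇒≤largest {xs = y ∷ ys} (here refl)  = m≤m⊔n y (largest ys)
∈⇒≤largest {xs = y ∷ ys} (there x∈ys) = ≤-trans (∈⇒≤largest x∈ys) (m≤n⊔m y (largest ys))

largest≤ : ∀ {b xs} → All (_≤ b) xs → largest xs ≤ b
largest≤ []           = z≤n
largest≤ (x≤b ∷ xs≤b) = ⊔-lub x≤b (largest≤ xs≤b)

largest∈ : ∀ {xs} → 1 ≤ length xs → largest xs ∈ xs
largest∈ {x ∷ xs} _ = largest-∷∈ x xs
  where
    largest-∷∈ : ∀ x xs → largest (x ∷ xs) ∈ x ∷ xs
    largest-∷∈ x []       = here (⊔-identityʳ x)
    largest-∷∈ x (y ∷ ys) with ⊔-sel x (largest (y ∷ ys))
    ... | inj₁ x⊔≡x = here x⊔≡x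
    ... | inj₂ x⊔≡  = there (subst (_∈ y ∷ ys) (sym x⊔≡) (largest-∷∈ y ys))

point : ℕ → ℕ → ℕ
point x y with y ≟ x
... | yes _ = x
... | no  _ = 0

point-≡ : ∀ x → point x x ≡ x
point-≡ x rewrite ≟-diag (refl {x = x}) = refl

point-≢ : ∀ {x y} → y ≢ x → point x y ≡ 0
point-≢ {x} {y} y≢x with y ≟ x
... | yes y≡x = ⊥-elim (y≢x y≡x)
... | no  _   = refl

sumFrom-point-below : ∀ {x} lo k → x < lo → sumFrom (point x) lo k ≡ 0
sumFrom-point-below lo zero    _    = refl
sumFrom-point-below lo (suc k) x<lo =
  cong₂ _+_ (point-≢ (>⇒≢ x<lo)) (sumFrom-point-below (suc lo) k (m<n⇒m<1+n x<lo))

sumFrom-point : ∀ {x} lo k → lo ≤ x → x < lo + k → sumFrom (point x) lo k ≡ x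
sumFrom-point lo zero    lo≤x x<hi = ⊥-elim (within-empty lo≤x x<hi)
sumFrom-point lo (suc k) lo≤x x<hi with within-cases lo≤x x<hi
... | inj₁ refl =
  trans (cong₂ _+_ (point-≡ lo) (sumFrom-point-below (suc lo) k ≤-refl)) (+-identityʳ lo)
... | inj₂ (lo<x , x<hi′) = cong₂ _+_ (point-≢ (<⇒≢ lo<x)) (sumFrom-point (suc lo) k lo<x x<hi′)

weight : List ℕ → ℕ → ℕ
weight []       y = 0
weight (x ∷ xs) y = point x y + weight xs y

sum≡sumFrom-weight : ∀ {lo k} xs → All (λ x → lo ≤ x × x < lo + k) xs →
                     sum xs ≡ sumFrom (weight xs) lo k
sum≡sumFrom-weight {lo} {k} []       []                       = sym (sumFrom-zero lo k)
sum≡sumFrom-weight {lo} {k} (x ∷ xs) ((lo≤x , x<hi) ∷ xs-in) = sym (begin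
  sumFrom (weight (x ∷ xs)) lo k
    ≡⟨ sumFrom-+ (point x) (weight xs) lo k ⟩
  sumFrom (point x) lo k + sumFrom (weight xs) lo k
    ≡⟨ cong₂ _+_ (sumFrom-point lo k lo≤x x<hi) (sym (sum≡sumFrom-weight xs xs-in)) ⟩
  x + sum xs ∎)
  where open ≡-Reasoning

weight-∉ : ∀ {xs y} → y ∉ xs → weight xs y ≡ 0
weight-∉ {[]}     _   = refl
weight-∉ {x ∷ xs} y∉ = cong₂ _+_ (point-≢ (y∉ ∘ here)) (weight-∉ (y∉ ∘ there))

weight-∈ : ∀ {xs y} → Linked _<_ xs → y ∈ xs → weight xs y ≡ y
weight-∈ {x ∷ xs} xs↗ (here refl) =
  trans (cong₂ _+_ (point-≡ x) (weight-∉ (head∉tail xs↗))) (+-identityʳ x)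
weight-∈ {x ∷ xs} xs↗ (there y∈xs) =
  cong₂ _+_ (point-≢ (>⇒≢ (All.lookup (head<tail xs↗) y∈xs))) (weight-∈ (Linked.tail xs↗) y∈xs)

consRange : ℕ → ℕ → List ℕ → List ℕ
consRange lo zero    t = t
consRange lo (suc k) t = lo ∷ consRange (suc lo) k t

∈-consRange⁺ˡ : ∀ {lo} k {t y} → lo ≤ y → y < lo + k → y ∈ consRange lo k t
∈-consRange⁺ˡ zero    lo≤y y<hi = ⊥-elim (within-empty lo≤y y<hi)
∈-consRange⁺ˡ (suc k) lo≤y y<hi with within-cases lo≤y y<hi
... | inj₁ refl          = here refl
... | inj₂ (lo<y , y<hi′) = there (∈-consRange⁺ˡ k lo<y y<hi′)

∈-consRange⁺ʳ : ∀ lo k {t y} → y ∈ t → y ∈ consRange lo k t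
∈-consRange⁺ʳ lo zero    y∈t = y∈t
∈-consRange⁺ʳ lo (suc k) y∈t = there (∈-consRange⁺ʳ (suc lo) k y∈t)

∈-consRange⁻ : ∀ lo k {t y} → y ∈ consRange lo k t → (lo ≤ y × y < lo + k) ⊎ y ∈ t
∈-consRange⁻ lo zero    y∈t          = inj₂ y∈t
∈-consRange⁻ lo (suc k) (here refl) = inj₁ (≤-refl , m<m+n lo z<s)
∈-consRange⁻ lo (suc k) {y = y} (there y∈) with ∈-consRange⁻ (suc lo) k y∈
... | inj₁ (lo<y , y<hi) = inj₁ (<⇒≤ lo<y , subst (y <_) (sym (+-suc lo k)) y<hi)
... | inj₂ y∈t           = inj₂ y∈t

sum-consRange : ∀ lo k t → sum (consRange lo k t) ≡ sumFrom id lo k + sum t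
sum-consRange lo zero    t = refl
sum-consRange lo (suc k) t = trans (cong (lo +_) (sum-consRange (suc lo) k t)) (sym (+-assoc lo _ _))

length-consRange : ∀ lo k t → length (consRange lo k t) ≡ k + length t
length-consRange lo zero    t = refl
length-consRange lo (suc k) t = cong suc (length-consRange (suc lo) k t)

consRange-increasing : ∀ lo k {t} → Linked _<_ t → All (lo + k ≤_) t → Linked _<_ (consRange lo k t)
consRange-increasing lo zero    t↗ _    = t↗
consRange-increasing lo (suc k) {t} t↗ t≥hi =
  cons-increasing (All.tabulate lo<) (consRange-increasing (suc lo) k t↗ t≥hi′)
  where
    t≥hi′ : All (suc lo + k ≤_) t
    t≥hi′ = All.map (λ {z} → subst (_≤ z) (+-suc lo k)) t≥hi
    lo< : ∀ {y} → y ∈ consRange (suc lo) k t → lo < y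
    lo< y∈ with ∈-consRange⁻ (suc lo) k y∈
    ... | inj₁ (lo<y , _) = lo<y
    ... | inj₂ y∈t        = <-≤-trans (m<m+n lo z<s) (All.lookup t≥hi y∈t)

module UnrefinablePartition {N μ} (μ-partition : IsDistinctPartition N μ)
                            (μ-unrefinable : ¬ Refinable μ) {L} (largest≡L : largest μ ≡ L) where

  open IsDistinctPartition μ-partition

  part≤L : ∀ {y} → y ∈ μ → y ≤ L
  part≤L y∈μ = subst (_ ≤_) largest≡L (∈⇒≤largest y∈μ)

  L∈μ : L ∈ μ
  L∈μ = subst (_∈ μ) largest≡L (largest∈ (<⇒≤ atLeastTwo))

  F : ℕ → ℕ
  F = weight μ

  F-∈ : ∀ {y} → y ∈ μ → F y ≡ y
  F-∈ = weight-∈ increasing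

  F-∉ : ∀ {y} → y ∉ μ → F y ≡ 0
  F-∉ = weight-∉

  F-cases : ∀ y → F y ≡ 0 ⊎ F y ≡ y
  F-cases y with y ∈? μ
  ... | yes y∈μ = inj₂ (F-∈ y∈μ)
  ... | no  y∉μ = inj₁ (F-∉ y∉μ)

  F≡0⇒∉ : ∀ {y} → 1 ≤ y → F y ≡ 0 → y ∉ μ
  F≡0⇒∉ 1≤y Fy≡0 y∈μ = <⇒≢ 1≤y (sym (trans (sym (F-∈ y∈μ)) Fy≡0))

  F≡⇒∈ : ∀ {y} → 1 ≤ y → F y ≡ y → y ∈ μ
  F≡⇒∈ {y} 1≤y Fy≡y with y ∈? μ
  ... | yes y∈μ = y∈μ
  ... | no  y∉μ = ⊥-elim (<⇒≢ 1≤y (trans (sym (F-∉ y∉μ)) Fy≡y))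

  pairWeight : ℕ → ℕ
  pairWeight a = F a + F (L ∸ a)

  -- a and L ∸ a are distinct and sum to the part L, so unrefinability forbids both to be missing.
  a≤pairWeight : ∀ {a} → 1 ≤ a → a + a < L → a ≤ pairWeight a
  a≤pairWeight {a} 1≤a a+a<L with a ∈? μ | (L ∸ a) ∈? μ
  ... | yes a∈μ | _        = subst (_≤ pairWeight a) (F-∈ a∈μ) (m≤m+n (F a) _)
  ... | no _    | yes a′∈μ = ≤-trans (m+n≤o⇒m≤o∸n a (<⇒≤ a+a<L))
                                     (subst (_≤ pairWeight a) (F-∈ a′∈μ) (m≤n+m _ (F a)))
  ... | no a∉μ  | no a′∉μ  = ⊥-elim (μ-unrefinable
          (a , L ∸ a , a≢L∸a , (1≤a , ≤largest a≤L , a∉μ) , (m<n⇒0<n∸m a<L , ≤largest (m∸n≤m L a) , a′∉μ) ,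
           subst (_∈ μ) (sym (m+[n∸m]≡n a≤L)) L∈μ))
    where
      a<L : a < L
      a<L = ≤-<-trans (m≤m+n a a) a+a<L
      a≤L : a ≤ L
      a≤L = <⇒≤ a<L
      ≤largest : ∀ {y} → y ≤ L → y ≤ largest μ
      ≤largest = subst (_ ≤_) (sym largest≡L)
      a≢L∸a : a ≢ L ∸ a
      a≢L∸a a≡L∸a = <⇒≢ a+a<L (trans (cong (a +_) a≡L∸a) (m+[n∸m]≡n a≤L))

  pairWeight<⇒ : ∀ {a} → 1 ≤ a → a + a < L → pairWeight a < L ∸ a → a ∈ μ × L ∸ a ∉ μ
  pairWeight<⇒ {a} 1≤a a+a<L small with (L ∸ a) ∈? μ
  ... | yes a′∈μ = ⊥-elim (<⇒≱ small (subst (_≤ pairWeight a) (F-∈ a′∈μ) (m≤n+m _ (F a))))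
  ... | no  a′∉μ with a ∈? μ
  ...   | yes a∈μ = a∈μ , a′∉μ
  ...   | no  a∉μ = ⊥-elim (<⇒≱ 1≤a (subst (a ≤_) pairWeight≡0 (a≤pairWeight 1≤a a+a<L)))
    where
      pairWeight≡0 : pairWeight a ≡ 0
      pairWeight≡0 = cong₂ _+_ (F-∉ a∉μ) (F-∉ a′∉μ)

  N≡pairs+middle+L : ∀ r c → L ≡ suc (r + c + r) →
                     N ≡ sumFrom pairWeight 1 r + sumFrom F (1 + r) c + L
  N≡pairs+middle+L r c L≡ = begin
    N                                              ≡⟨ sym sums ⟩
    sum μ                                          ≡⟨ sum≡sumFrom-weight μ (All.tabulate in-range) ⟩
    sumFrom F 1 L                                  ≡⟨ cong (sumFrom F 1) L≡ ⟩
    sumFrom F 1 (suc (r + c + r))                  ≡⟨ sumFrom-snoc F 1 (r + c + r) ⟩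
    sumFrom F 1 (r + c + r) + F (suc (r + c + r))  ≡⟨ cong₂ _+_ pairs F-top ⟩
    sumFrom pairWeight 1 r + sumFrom F (1 + r) c + L ∎
    where
      open ≡-Reasoning
      in-range : ∀ {y} → y ∈ μ → 1 ≤ y × y < 1 + L
      in-range y∈μ = All.lookup positive y∈μ , s≤s (part≤L y∈μ)
      pairs : sumFrom F 1 (r + c + r) ≡ sumFrom pairWeight 1 r + sumFrom F (1 + r) c
      pairs = sumFrom-pairs F 1 r c L (cong suc (sym L≡))
      F-top : F (suc (r + c + r)) ≡ L
      F-top = trans (cong F (sym L≡)) (F-∈ L∈μ)

  triangle+L≤N : ∀ r → r + r < L → triangle r + L ≤ N
  triangle+L≤N r r+r<L = begin
    triangle r + L                                     ≤⟨ +-monoˡ-≤ L triangle≤pairWeights ⟩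
    sumFrom pairWeight 1 r + L                         ≤⟨ +-monoˡ-≤ L (m≤m+n _ _) ⟩
    sumFrom pairWeight 1 r + sumFrom F (1 + r) c + L   ≡⟨ sym (N≡pairs+middle+L r c L≡) ⟩
    N                                                  ∎
    where
      open ≤-Reasoning
      c = L ∸ suc (r + r)
      L≡ : L ≡ suc (r + c + r)
      L≡ = trans (sym (m+[n∸m]≡n r+r<L)) (cong suc (reorder r c))
        where
          reorder : ∀ r c → r + r + c ≡ r + c + r
          reorder = solve-∀
      triangle≤pairWeights : triangle r ≤ sumFrom pairWeight 1 r
      triangle≤pairWeights = sumFrom-mono pairWeight id 1 r λ 1≤a a<1+r →
        a≤pairWeight 1≤a (≤-<-trans (+-mono-≤ (s≤s⁻¹ a<1+r) (s≤s⁻¹ a<1+r)) r+r<L)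

maxPart : ℕ → ℕ
maxPart m = 4 + (m + m)

maxPartition : ℕ → List ℕ
maxPartition m = consRange 1 m (3 + m ∷ maxPart m ∷ [])

∈-maxPartition⁻ : ∀ {m y} → y ∈ maxPartition m →
                  (1 ≤ y × y < 1 + m) ⊎ (y ≡ 3 + m ⊎ y ≡ maxPart m)
∈-maxPartition⁻ {m} y∈ with ∈-consRange⁻ 1 m y∈
... | inj₁ y∈range          = inj₁ y∈range
... | inj₂ (here y≡)        = inj₂ (inj₁ y≡)
... | inj₂ (there (here y≡)) = inj₂ (inj₂ y≡)

3+m∈maxPartition : ∀ m → 3 + m ∈ maxPartition m
3+m∈maxPartition m = ∈-consRange⁺ʳ 1 m (here refl)

maxPart∈maxPartition : ∀ m → maxPart m ∈ maxPartition m
maxPart∈maxPartition m = ∈-consRange⁺ʳ 1 m (there (here refl))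

maxPartition-increasing : ∀ m → Linked _<_ (maxPartition m)
maxPartition-increasing m =
  consRange-increasing 1 m (3+m<maxPart ∷ [-]) (1+m≤3+m ∷ 1+m≤maxPart ∷ [])
  where
    3+m<maxPart : 3 + m < maxPart m
    3+m<maxPart = s≤s (s≤s (s≤s (s≤s (m≤n+m m m))))
    1+m≤3+m : 1 + m ≤ 3 + m
    1+m≤3+m = m≤n+m (1 + m) 2
    1+m≤maxPart : 1 + m ≤ maxPart m
    1+m≤maxPart = ≤-trans 1+m≤3+m (<⇒≤ 3+m<maxPart)

largest-maxPartition : ∀ m → largest (maxPartition m) ≡ maxPart m
largest-maxPartition m =
  ≤-antisym (largest≤ (All.tabulate ≤maxPart)) (∈⇒≤largest (maxPart∈maxPartition m))
  where
    ≤maxPart : ∀ {y} → y ∈ maxPartition m → y ≤ maxPart m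
    ≤maxPart y∈ with ∈-maxPartition⁻ y∈
    ... | inj₁ (_ , y<1+m)  = ≤-trans (<⇒≤ y<1+m) (s≤s (≤-trans (m≤m+n m m) (m≤n+m (m + m) 3)))
    ... | inj₂ (inj₁ refl) = s≤s (s≤s (s≤s (≤-trans (m≤n+m m m) (n≤1+n (m + m)))))
    ... | inj₂ (inj₂ refl) = ≤-refl

sum-maxPartition : ∀ m → sum (maxPartition m) ≡ triangle m + (3 + m) + maxPart m
sum-maxPartition m = begin
  sum (maxPartition m)                     ≡⟨ sum-consRange 1 m (3 + m ∷ maxPart m ∷ []) ⟩
  triangle m + ((3 + m) + (maxPart m + 0)) ≡⟨ cong (λ z → triangle m + ((3 + m) + z)) (+-identityʳ _) ⟩
  triangle m + ((3 + m) + maxPart m)       ≡⟨ sym (+-assoc (triangle m) (3 + m) (maxPart m)) ⟩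
  triangle m + (3 + m) + maxPart m         ∎
  where open ≡-Reasoning

T-4+m : ∀ m → T (4 + m) ≡ triangle m + (3 + m) + maxPart m
T-4+m m = begin
  (4 + m) * (4 + m + 1) / 2 ∸ (3 + m)  ≡⟨ cong (λ z → z / 2 ∸ (3 + m)) doubled ⟩
  (M + (3 + m)) * 2 / 2 ∸ (3 + m)      ≡⟨ cong (_∸ (3 + m)) (m*n/n≡m (M + (3 + m)) 2) ⟩
  M + (3 + m) ∸ (3 + m)                ≡⟨ m+n∸n≡m M (3 + m) ⟩
  M                                    ∎
  where
    open ≡-Reasoning
    M = triangle m + (3 + m) + maxPart m
    expand : ∀ t m → t * 2 + (20 + 8 * m) ≡ (t + (3 + m) + (4 + (m + m)) + (3 + m)) * 2
    expand = solve-∀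
    square : ∀ m → (4 + m) * (4 + m + 1) ≡ m * suc m + (20 + 8 * m)
    square = solve-∀
    doubled : (4 + m) * (4 + m + 1) ≡ (M + (3 + m)) * 2
    doubled = trans (square m) (trans (cong (_+ (20 + 8 * m)) (sym (triangle-*2 m))) (expand (triangle m) m))

maxPartition-isDistinctPartition : ∀ m → IsDistinctPartition (T (4 + m)) (maxPartition m)
maxPartition-isDistinctPartition m = record
  { increasing = maxPartition-increasing m
  ; positive   = All.tabulate positive
  ; atLeastTwo = subst (2 ≤_) (sym (length-consRange 1 m _)) (m≤n+m 2 m)
  ; sums       = trans (sum-maxPartition m) (sym (T-4+m m))
  }
  where
    positive : ∀ {y} → y ∈ maxPartition m → 0 < y
    positive y∈ with ∈-maxPartition⁻ y∈
    ... | inj₁ (1≤y , _)   = 1≤y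
    ... | inj₂ (inj₁ refl) = z<s
    ... | inj₂ (inj₂ refl) = z<s

distinct-sum-≥ : ∀ {k a b} → k ≤ a → k ≤ b → a ≢ b → suc (k + k) ≤ a + b
distinct-sum-≥ {k} {b = b} k≤a k≤b a≢b with m≤n⇒m<n∨m≡n k≤a
... | inj₁ k<a  = +-mono-≤ k<a k≤b
... | inj₂ refl = subst (_≤ k + b) (+-suc k k) (+-monoʳ-≤ k (≤∧≢⇒< k≤b a≢b))

offsets-sum≡2 : ∀ i j → i + j ≡ 2 → i ≢ j → i ≡ 2 ⊎ j ≡ 2
offsets-sum≡2 0 j                   i+j≡2 _   = inj₂ i+j≡2
offsets-sum≡2 1 1                   _     i≢j = ⊥-elim (i≢j refl)
offsets-sum≡2 2 0                   _     _   = inj₁ refl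
offsets-sum≡2 1 0                   ()
offsets-sum≡2 1 (suc (suc j))       ()
offsets-sum≡2 2 (suc j)             ()
offsets-sum≡2 (suc (suc (suc i))) j ()

missing-maxPartition : ∀ {m a} → Missing (maxPartition m) a → 1 + m ≤ a × a ≢ 3 + m
missing-maxPartition {m} {a} (1≤a , _ , a∉) with a <? 1 + m
... | yes a<1+m = ⊥-elim (a∉ (∈-consRange⁺ˡ m 1≤a a<1+m))
... | no  a≮1+m =
  ≮⇒≥ a≮1+m , λ a≡3+m → a∉ (subst (_∈ maxPartition m) (sym a≡3+m) (3+m∈maxPartition m))

distinct-sum≡maxPart : ∀ {m a b} → 1 + m ≤ a → 1 + m ≤ b → a ≢ b → a + b ≡ maxPart m →
                       a ≡ 3 + m ⊎ b ≡ 3 + m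
distinct-sum≡maxPart {m} 1+m≤a 1+m≤b a≢b a+b≡maxPart
  with m≤n⇒∃[o]m+o≡n 1+m≤a | m≤n⇒∃[o]m+o≡n 1+m≤b
... | i , refl | j , refl with offsets-sum≡2 i j i+j≡2 (a≢b ∘ cong (1 + m +_))
  where
    regroup : ∀ m i j → 1 + m + i + (1 + m + j) ≡ 2 + (m + m) + (i + j)
    regroup = solve-∀
    maxPart≡ : ∀ m → 4 + (m + m) ≡ 2 + (m + m) + 2
    maxPart≡ = solve-∀
    i+j≡2 : i + j ≡ 2
    i+j≡2 = +-cancelˡ-≡ (2 + (m + m)) _ _ (trans (sym (regroup m i j)) (trans a+b≡maxPart (maxPart≡ m)))
... | inj₁ refl = inj₁ (+-comm (1 + m) 2)
... | inj₂ refl = inj₂ (+-comm (1 + m) 2)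

-- Missing parts are at least m + 1, so two distinct ones sum to at least 2m + 3: too much for
-- every part but 2m + 4, which is only (m + 1) + (m + 3) = (m + 2) + (m + 2).
maxPartition-unrefinable : ∀ {m} → 1 ≤ m → ¬ Refinable (maxPartition m)
maxPartition-unrefinable {m} 1≤m (a , b , a≢b , a-missing , b-missing , a+b∈)
  with missing-maxPartition a-missing | missing-maxPartition b-missing | ∈-maxPartition⁻ a+b∈
... | 1+m≤a , _ | _ | inj₁ (_ , a+b<1+m) = <⇒≱ a+b<1+m (≤-trans 1+m≤a (m≤m+n a b))
... | 1+m≤a , _ | 1+m≤b , _ | inj₂ (inj₁ a+b≡3+m) =
  <⇒≱ 1≤m (+-cancelʳ-≤ (suc m) m 0 (s≤s⁻¹ (s≤s⁻¹ 2m+3≤m+3)))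
  where
    2m+3≤m+3 : suc ((1 + m) + (1 + m)) ≤ 3 + m
    2m+3≤m+3 = subst (suc ((1 + m) + (1 + m)) ≤_) a+b≡3+m (distinct-sum-≥ 1+m≤a 1+m≤b a≢b)
... | 1+m≤a , a≢3+m | 1+m≤b , b≢3+m | inj₂ (inj₂ a+b≡maxPart) =
  [ a≢3+m , b≢3+m ]′ (distinct-sum≡maxPart 1+m≤a 1+m≤b a≢b a+b≡maxPart)

triangle-2+m : ∀ m → triangle (2 + m) ≡ triangle m + (1 + m) + (2 + m)
triangle-2+m m = trans (sumFrom-snoc id 1 (1 + m)) (cong (_+ (2 + m)) (sumFrom-snoc id 1 m))

largest-bound : ∀ {m μ} → IsDistinctPartition (T (4 + m)) μ → ¬ Refinable μ → largest μ ≤ maxPart m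
largest-bound {m} {μ} μ-partition μ-unrefinable = ≮⇒≥ too-large
  where
    open UnrefinablePartition μ-partition μ-unrefinable refl
    regroup : ∀ t m → t + (3 + m) + (4 + (m + m)) + suc m ≡ t + (1 + m) + (2 + m) + suc (4 + (m + m))
    regroup = solve-∀
    halves : ∀ m → 4 + (m + m) ≡ (2 + m) + (2 + m)
    halves = solve-∀
    too-large : ¬ maxPart m < largest μ
    too-large maxPart<L = m+1+n≰m (T (4 + m)) (begin
      T (4 + m) + suc m                                 ≡⟨ cong (_+ suc m) (T-4+m m) ⟩
      triangle m + (3 + m) + maxPart m + suc m          ≡⟨ regroup (triangle m) m ⟩
      triangle m + (1 + m) + (2 + m) + suc (maxPart m)  ≤⟨ +-monoʳ-≤ _ maxPart<L ⟩
      triangle m + (1 + m) + (2 + m) + largest μ        ≡⟨ cong (_+ largest μ) (sym (triangle-2+m m)) ⟩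
      triangle (2 + m) + largest μ                      ≤⟨ triangle+L≤N (2 + m) (subst (_< largest μ) (halves m) maxPart<L) ⟩
      T (4 + m)                                         ∎)
      where open ≤-Reasoning

middle-weights : ∀ {m u v w} → 1 ≤ m →
                 u ≡ 0 ⊎ u ≡ 1 + m → v ≡ 0 ⊎ v ≡ 2 + m → w ≡ 0 ⊎ w ≡ 3 + m →
                 u + w + v ≡ 3 + m → u ≡ 0 × v ≡ 0 × w ≡ 3 + m
middle-weights {m} {u} {v} _ _ _ (inj₂ refl) sum≡ =
  m+n≡0⇒m≡0 u u+v≡0 , m+n≡0⇒n≡0 u u+v≡0 , refl
  where
    u+v≡0 : u + v ≡ 0
    u+v≡0 = +-cancelʳ-≡ (3 + m) (u + v) 0 (trans (sym (xy∙z≈xz∙y u (3 + m) v)) sum≡)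
middle-weights _ (inj₁ refl) (inj₁ refl) (inj₁ refl) ()
middle-weights _ (inj₁ refl) (inj₂ refl) (inj₁ refl) sum≡ = ⊥-elim (1+n≢n (sym sum≡))
middle-weights {m} _ (inj₂ refl) (inj₁ refl) (inj₁ refl) sum≡ =
  ⊥-elim (m≢1+n+m (suc m) {1} (trans (sym (trans (+-identityʳ _) (+-identityʳ (suc m)))) sum≡))
middle-weights {m} 1≤m (inj₂ refl) (inj₂ refl) (inj₁ refl) sum≡ = ⊥-elim (<⇒≢ 1≤m (sym m≡0))
  where
    regroup : ∀ m → 1 + m + 0 + (2 + m) ≡ 3 + m + m
    regroup = solve-∀
    m≡0 : m ≡ 0
    m≡0 = +-cancelˡ-≡ (3 + m) m 0 (trans (sym (regroup m)) (trans sum≡ (sym (+-identityʳ (3 + m)))))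

module MaxPartitionUnique {m} (1≤m : 1 ≤ m) {μ} (μ-partition : IsDistinctPartition (T (4 + m)) μ)
                          (μ-unrefinable : ¬ Refinable μ) (largest≡ : largest μ ≡ maxPart m) where

  open IsDistinctPartition μ-partition
  open UnrefinablePartition μ-partition μ-unrefinable largest≡

  sum-split : triangle m + (3 + m) ≡ sumFrom pairWeight 1 m + pairWeight (1 + m) + F (2 + m)
  sum-split = +-cancelʳ-≡ (maxPart m) _ _ (begin
    triangle m + (3 + m) + maxPart m
      ≡⟨ sym (T-4+m m) ⟩
    T (4 + m)
      ≡⟨ N≡pairs+middle+L (1 + m) 1 (maxPart≡ m) ⟩
    sumFrom pairWeight 1 (1 + m) + (F (2 + m) + 0) + maxPart m
      ≡⟨ cong₂ (λ x z → x + z + maxPart m) (sumFrom-snoc pairWeight 1 m) (+-identityʳ (F (2 + m))) ⟩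
    sumFrom pairWeight 1 m + pairWeight (1 + m) + F (2 + m) + maxPart m ∎)
    where
      open ≡-Reasoning
      maxPart≡ : ∀ m → 4 + (m + m) ≡ suc (1 + m + 1 + (1 + m))
      maxPart≡ = solve-∀

  a≤pairWeight-≤1+m : Within 1 (1 + m) (λ a → a ≤ pairWeight a)
  a≤pairWeight-≤1+m {a} 1≤a a<2+m = a≤pairWeight 1≤a (≤-<-trans (+-mono-≤ a≤1+m a≤1+m) bound)
    where
      a≤1+m : a ≤ 1 + m
      a≤1+m = s≤s⁻¹ a<2+m
      offset : ∀ m → suc (1 + m + (1 + m)) + 1 ≡ 4 + (m + m)
      offset = solve-∀
      bound : (1 + m) + (1 + m) < maxPart m
      bound = ≤″⇒≤ record { equality = offset m }

  pairWeights≤ : sumFrom pairWeight 1 m ≤ triangle m + 2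
  pairWeights≤ = +-cancelʳ-≤ (1 + m) _ _ (begin
    sumFrom pairWeight 1 m + (1 + m)
      ≤⟨ +-monoʳ-≤ _ (a≤pairWeight-≤1+m (s≤s z≤n) ≤-refl) ⟩
    sumFrom pairWeight 1 m + pairWeight (1 + m)
      ≤⟨ m≤m+n _ (F (2 + m)) ⟩
    sumFrom pairWeight 1 m + pairWeight (1 + m) + F (2 + m)
      ≡⟨ sym sum-split ⟩
    triangle m + (2 + (1 + m))
      ≡⟨ sym (+-assoc (triangle m) 2 (1 + m)) ⟩
    triangle m + 2 + (1 + m) ∎)
    where open ≤-Reasoning

  pairWeight≤ : Within 1 m (λ a → pairWeight a ≤ a + 2)
  pairWeight≤ = sumFrom-slack pairWeight id 1 m 2
    (λ 1≤a a<1+m → a≤pairWeight-≤1+m 1≤a (m<n⇒m<1+n a<1+m)) pairWeights≤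

  -- pairWeight a ≤ a + 2 < L ∸ a leaves a ∈ μ, L ∸ a ∉ μ as the only possibility.
  lower-half : Within 1 m (λ a → a ∈ μ × maxPart m ∸ a ∉ μ)
  lower-half {a} 1≤a a<1+m =
    pairWeight<⇒ 1≤a a+a<L (<-≤-trans (s≤s (pairWeight≤ 1≤a a<1+m)) a+3≤L∸a)
    where
      a≤m : a ≤ m
      a≤m = s≤s⁻¹ a<1+m
      bound₁ : ∀ m → suc (m + m) + 3 ≡ 4 + (m + m)
      bound₁ = solve-∀
      bound₂ : ∀ m → suc (m + 2) + m + 1 ≡ 4 + (m + m)
      bound₂ = solve-∀
      a+a<L : a + a < maxPart m
      a+a<L = ≤-<-trans (+-mono-≤ a≤m a≤m) (≤″⇒≤ record { equality = bound₁ m })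
      a+3≤L∸a : suc (a + 2) ≤ maxPart m ∸ a
      a+3≤L∸a = m+n≤o⇒m≤o∸n (suc (a + 2))
        (≤-trans (+-mono-≤ (s≤s (+-monoˡ-≤ 2 a≤m)) a≤m) (≤″⇒≤ record { equality = bound₂ m }))

  middle-sum : F (1 + m) + F (3 + m) + F (2 + m) ≡ 3 + m
  middle-sum = +-cancelˡ-≡ (triangle m) _ _ (begin
    triangle m + (F (1 + m) + F (3 + m) + F (2 + m))
      ≡⟨ sym (+-assoc (triangle m) _ _) ⟩
    triangle m + (F (1 + m) + F (3 + m)) + F (2 + m)
      ≡⟨ cong₂ (λ x y → x + (F (1 + m) + F y) + F (2 + m)) (sym pairWeights≡triangle) (sym L∸[1+m]≡3+m) ⟩
    sumFrom pairWeight 1 m + pairWeight (1 + m) + F (2 + m)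
      ≡⟨ sym sum-split ⟩
    triangle m + (3 + m) ∎)
    where
      open ≡-Reasoning
      pairWeights≡triangle : sumFrom pairWeight 1 m ≡ triangle m
      pairWeights≡triangle = sumFrom-cong id pairWeight 1 m λ 1≤a a<1+m →
        let a∈μ , a′∉μ = lower-half 1≤a a<1+m
        in  trans (cong₂ _+_ (F-∈ a∈μ) (F-∉ a′∉μ)) (+-identityʳ _)
      L∸[1+m]≡3+m : maxPart m ∸ (1 + m) ≡ 3 + m
      L∸[1+m]≡3+m = m+n∸n≡m (3 + m) m

  middle : 1 + m ∉ μ × 2 + m ∉ μ × 3 + m ∈ μ
  middle with middle-weights 1≤m (F-cases (1 + m)) (F-cases (2 + m)) (F-cases (3 + m)) middle-sum
  ... | u≡0 , v≡0 , w≡3+m = F≡0⇒∉ z<s u≡0 , F≡0⇒∉ z<s v≡0 , F≡⇒∈ z<s w≡3+m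

  middle-gap : ∀ {y} → 1 + m ≤ y → y < 3 + m → y ∉ μ
  middle-gap 1+m≤y y<3+m with m≤n⇒m<n∨m≡n 1+m≤y
  ... | inj₂ refl  = proj₁ middle
  ... | inj₁ 1+m<y = subst (_∉ μ) (≤-antisym 1+m<y (s≤s⁻¹ y<3+m)) (proj₁ (proj₂ middle))

  above-middle : ∀ {y} → 3 + m < y → y ∈ μ → y ≡ maxPart m
  above-middle {y} 3+m<y y∈μ with m≤n⇒m<n∨m≡n (part≤L y∈μ)
  ... | inj₂ y≡L = y≡L
  ... | inj₁ y<L = ⊥-elim (proj₂ (lower-half (m<n⇒0<n∸m y<L) a<1+m)
                            (subst (_∈ μ) (sym (m∸[m∸n]≡n (<⇒≤ y<L))) y∈μ))
    where
      offset : ∀ m → suc (4 + (m + m)) + 0 ≡ 4 + m + (1 + m)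
      offset = solve-∀
      L<y+1+m : maxPart m < y + (1 + m)
      L<y+1+m = <-≤-trans (≤″⇒≤ record { equality = offset m }) (+-monoˡ-≤ (1 + m) 3+m<y)
      a<1+m : maxPart m ∸ y < 1 + m
      a<1+m = m<n+o⇒m∸n<o (maxPart m) y L<y+1+m

  μ⊆maxPartition : ∀ {y} → y ∈ μ → y ∈ maxPartition m
  μ⊆maxPartition {y} y∈μ with y <? 1 + m | <-cmp y (3 + m)
  ... | yes y<1+m | _                = ∈-consRange⁺ˡ m (All.lookup positive y∈μ) y<1+m
  ... | no  _     | tri≈ _ refl _    = 3+m∈maxPartition m
  ... | no  y≮1+m | tri< y<3+m _ _   = ⊥-elim (middle-gap (≮⇒≥ y≮1+m) y<3+m y∈μ)
  ... | no  _     | tri> _ _ 3+m<y   =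
    subst (_∈ maxPartition m) (sym (above-middle 3+m<y y∈μ)) (maxPart∈maxPartition m)

  maxPartition⊆μ : ∀ {y} → y ∈ maxPartition m → y ∈ μ
  maxPartition⊆μ y∈ with ∈-maxPartition⁻ y∈
  ... | inj₁ (1≤y , y<1+m) = proj₁ (lower-half 1≤y y<1+m)
  ... | inj₂ (inj₁ refl)   = proj₂ (proj₂ middle)
  ... | inj₂ (inj₂ refl)   = L∈μ

  μ≡maxPartition : μ ≡ maxPartition m
  μ≡maxPartition = increasing-ext increasing (maxPartition-increasing m) μ⊆maxPartition maxPartition⊆μ

corollary3p1 : (n : ℕ) → 11 ≤ n → ExactlyOneMax (T n)
corollary3p1 (suc (suc (suc (suc m)))) (s≤s (s≤s (s≤s (s≤s 7≤m)))) =
  maxPartition m , (unrefinable , maximal) , unique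
  where
    -- The argument only needs n ≥ 5.
    1≤m : 1 ≤ m
    1≤m = ≤-trans (s≤s z≤n) 7≤m
    unrefinable : Unrefinable (T (4 + m)) (maxPartition m)
    unrefinable = maxPartition-isDistinctPartition m , maxPartition-unrefinable 1≤m
    maximal : ∀ μ → Unrefinable (T (4 + m)) μ → largest μ ≤ largest (maxPartition m)
    maximal μ (μ-partition , μ-unrefinable) =
      subst (largest μ ≤_) (sym (largest-maxPartition m)) (largest-bound {m} μ-partition μ-unrefinable)
    unique : ∀ μ → MaxUnrefinable (T (4 + m)) μ → μ ≡ maxPartition m
    unique μ ((μ-partition , μ-unrefinable) , μ-maximal) =
      MaxPartitionUnique.μ≡maxPartition 1≤m μ-partition μ-unrefinable
        (≤-antisym (largest-bound {m} μ-partition μ-unrefinable)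
                   (subst (_≤ largest μ) (largest-maxPartition m) (μ-maximal (maxPartition m) unrefinable)))
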